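{- Let $G=(V,E)$ be a finite simple graph and $K\subseteq E$. Then $K=E(\Pi)$ for some Conn-Pac $\Pi$ of $G$ if and only if every chordless cycle $C$ of $G$, viewed as its set of edges, satisfies $|C\setminus K|\neq 1$.
   Context: A Conn-Pac of $G$ is a partition $\Pi=\{V_1,\dots,V_t\}$ of $V$ such that each induced subgraph $G[V_i]$ is connected. For such $\Pi$, $E(\Pi):=\{\{u,v\}\in E:\ \exists i\le t,\ u,v\in V_i\}$. A cycle is chordless if no edge of $G$ joins two non-consecutive vertices of it. -}

module Defs where

open import Level using (0ℓ)
open import Data.Nat using (ℕ; suc; _+_)
open import Data.Nat.DivMod using (_mod_)
open import Data.Fin using (Fin; toℕ)
open import Data.List using (List; length; filter; allFin)
open import Data.Product using (_×_; Σ)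
open import Data.Sum using (_⊎_)
open import Data.Empty using (⊥)
open import Relation.Nullary using (¬_; ¬?)
open import Relation.Binary using (Rel; Symmetric; Irreflexive; Decidable)
open import Relation.Binary.PropositionalEquality using (_≡_)
open import Function using (Injective)
open import Function.Bundles using (_⇔_)

record Graph : Set₁ where
  field
    n       : ℕ
    Adj     : Rel (Fin n) 0ℓ
    sym     : Symmetric Adj
    irrefl  : Irreflexive _≡_ Adj
    adj?    : Decidable Adj

record EdgeSubset (G : Graph) : Set₁ where
  open Graph G
  field
    In     : Rel (Fin n) 0ℓ
    sym    : Symmetric In
    sub    : ∀ {u v} → In u v → Adj u v
    in?    : Decidable In

module _ (G : Graph) where
  open Graph G

  -- walks in G all of whose vertices satisfy P (i.e. walks in G[P])
  data WalkIn (P : Fin n → Set) : Fin n → Fin n → Set where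
    stay : ∀ {u} → P u → WalkIn P u u
    step : ∀ {u w v} → P u → Adj u w → WalkIn P w v → WalkIn P u v

  -- A partition Π of V represented by a block-label map c; the blocks V_i
  -- are the nonempty fibres of c.
  Partition : Set
  Partition = Fin n → Fin n

  IsConnPac : Partition → Set
  IsConnPac c = ∀ u v → c u ≡ c v → WalkIn (λ x → c x ≡ c u) u v

  EΠ : Partition → Rel (Fin n) 0ℓ
  EΠ c u v = Adj u v × c u ≡ c v

  next : ∀ {m} → Fin (suc m) → Fin (suc m)
  next {m} i = suc (toℕ i) mod (suc m)

  record ChordlessCycle (m : ℕ) : Set where
    field
      vtx       : Fin (3 + m) → Fin n
      distinct  : Injective _≡_ _≡_ vtx
      edges     : ∀ i → Adj (vtx i) (vtx (next i))
      chordless : ∀ i j → Adj (vtx i) (vtx j) → (j ≡ next i) ⊎ (i ≡ next j)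

  missing : (K : EdgeSubset G) → ∀ {m} → ChordlessCycle m → ℕ
  missing K {m} C =
    length (filter (λ i → ¬? (EdgeSubset.in? K (vtx i) (vtx (next i)))) (allFin (3 + m)))
    where open ChordlessCycle C

{-# OPTIONS --safe #-}
module Submission where

-- (⇒) If a chordless cycle had exactly one edge xy outside E(Π), the other edges keep every
-- vertex of the cycle in one block, so xy ∈ E(Π) after all.
-- (⇐) Let Π be the components of (V, K). An edge uv of G inside a component closes a K-walk
-- from u to v; induct on its length. A repeated vertex, or a chord of the closed walk other
-- than uv, gives a shorter K-walk (the chord lies in K by induction). Otherwise the walk and
-- uv form a chordless cycle whose only edge outside K is uv, which the hypothesis forbids.

open import Defs
open import Data.Nat using (ℕ)
open import Data.Product using (Σ; _×_)
open import Relation.Binary.PropositionalEquality using (_≢_)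
open import Function.Bundles using (_⇔_)

open import Level using (0ℓ)
open import Data.Empty using (⊥-elim)
open import Data.Nat using (zero; suc; _+_; _*_; _∸_; _<_; _≤_; z<s; s≤s; s≤s⁻¹; _%_; _/_; _<?_; _≟_; NonZero)
open import Data.Nat.Properties
open import Data.Nat.DivMod using (_mod_; m≡m%n+[m/n]*n; %-distribˡ-+; m%n%n≡m%n; [m+n]%n≡m%n; m<n⇒m%n≡m; n%n≡0)
open import Data.Nat.Induction using (<-rec)
open import Data.Fin using (Fin; toℕ; fromℕ; fromℕ<)
open import Data.Fin.Properties using (toℕ-injective; toℕ<n; toℕ-fromℕ; toℕ-fromℕ<; any?; pigeonhole) renaming (_≟_ to _≟ᶠ_)
open import Data.List using (List; []; _∷_; length; filter; allFin; head)
open import Data.List.Membership.Propositional using (_∈_)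
open import Data.List.Membership.Propositional.Properties using (∈-filter⁺; ∈-filter⁻; ∈-allFin)
open import Data.List.Relation.Unary.Any using (here; there)
open import Data.List.Relation.Unary.Any.Properties using (singleton⁻)
open import Data.List.Relation.Unary.All as All using ()
open import Data.List.Relation.Unary.AllPairs using (_∷_)
open import Data.List.Relation.Unary.Unique.Propositional using (Unique)
open import Data.List.Relation.Unary.Unique.Propositional.Properties using (allFin⁺)
open import Data.List.Properties using (filter-none; filter-≐)
open import Data.Maybe using (fromMaybe)
open import Data.Product using (_,_; proj₂; ∃₂; ∃-syntax)
open import Data.Sum using (_⊎_; inj₁; inj₂; swap)
open import Function using (_∘_)
open import Function.Bundles using (mk⇔; Equivalence)
open import Relation.Nullary using (¬_; yes; no; ¬?)
open import Relation.Nullary.Decidable using (map′; _×-dec_; ¬¬-excluded-middle; decidable-stable)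
open import Relation.Unary using (Pred; _≐_) renaming (Decidable to Decidable₁)
open import Relation.Binary using (Rel; Symmetric; Decidable; IsDecEquivalence; tri<; tri≈; tri>)
open import Relation.Binary.PropositionalEquality using (_≡_; refl; sym; trans; cong; subst; subst₂; module ≡-Reasoning)

module _ {a p} {A : Set a} {P : Pred A p} (P? : Decidable₁ P) where

  length-filter≡1 : ∀ {x xs} → Unique xs → x ∈ xs → P x → (∀ {y} → P y → y ≡ x) →
                    length (filter P? xs) ≡ 1
  length-filter≡1 {xs = y ∷ ys} (y∉ys ∷ _) _ _ only with P? y
  ... | yes py rewrite filter-none P? (All.map (λ y≢z pz → y≢z (trans (only py) (sym (only pz)))) y∉ys)
    = refl
  length-filter≡1 (_ ∷ _) (here refl) px _ | no ¬py = ⊥-elim (¬py px)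
  length-filter≡1 (_ ∷ u) (there x∈ys) px only | no _ = length-filter≡1 u x∈ys px only

  length-filter≡1⇒ : ∀ xs → length (filter P? xs) ≡ 1 →
                     ∃[ x ] P x × (∀ {y} → y ∈ xs → P y → y ≡ x)
  length-filter≡1⇒ xs len with filter P? xs in eq
  ... | x ∷ [] = x , proj₂ (∈-filter⁻ P? {xs = xs} (subst (x ∈_) (sym eq) (here refl))) ,
                 λ y∈xs py → singleton⁻ (subst (_ ∈_) eq (∈-filter⁺ P? y∈xs py))

module _ {A : Set} {d x : A} where

  fromMaybe-head-∈ : ∀ {xs} → x ∈ xs → fromMaybe d (head xs) ∈ xs
  fromMaybe-head-∈ {_ ∷ _} _ = here refl

  fromMaybe-head-irrelevant : ∀ {d′ xs} → x ∈ xs → fromMaybe d (head xs) ≡ fromMaybe d′ (head xs)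
  fromMaybe-head-irrelevant {xs = _ ∷ _} _ = refl

module Representative {n} {_∼_ : Rel (Fin n) 0ℓ} (isDecEquivalence : IsDecEquivalence _∼_) where
  open IsDecEquivalence isDecEquivalence
    renaming (refl to ∼-refl; sym to ∼-sym; trans to ∼-trans; _≟_ to _∼?_)

  class : Fin n → List (Fin n)
  class u = filter (u ∼?_) (allFin n)

  ∈-class : ∀ {u v} → u ∼ v → v ∈ class u
  ∈-class {u} u∼v = ∈-filter⁺ (u ∼?_) (∈-allFin _) u∼v

  rep : Fin n → Fin n
  rep u = fromMaybe u (head (class u))

  rep-∼ : ∀ u → u ∼ rep u
  rep-∼ u = proj₂ (∈-filter⁻ (u ∼?_) {xs = allFin n} (fromMaybe-head-∈ (∈-class ∼-refl)))

  ∼⇒rep≡ : ∀ {u v} → u ∼ v → rep u ≡ rep v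
  ∼⇒rep≡ {u} {v} u∼v = begin
    fromMaybe u (head (class u))
      ≡⟨ cong (fromMaybe u ∘ head) (filter-≐ (u ∼?_) (v ∼?_) same-class (allFin n)) ⟩
    fromMaybe u (head (class v)) ≡⟨ fromMaybe-head-irrelevant (∈-class ∼-refl) ⟩
    fromMaybe v (head (class v)) ∎
    where
    open ≡-Reasoning
    same-class : (u ∼_) ≐ (v ∼_)
    same-class = (λ u∼x → ∼-trans (∼-sym u∼v) u∼x) , (λ v∼x → ∼-trans u∼v v∼x)

  rep≡⇒∼ : ∀ {u v} → rep u ≡ rep v → u ∼ v
  rep≡⇒∼ {u} {v} eq = ∼-trans (rep-∼ u) (∼-sym (subst (v ∼_) (sym eq) (rep-∼ v)))

shortcut-shorter : ∀ {d e i j} → i ≤ j → j ≤ d → e < j ∸ i → i + (e + (d ∸ j)) < d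
shortcut-shorter {d} {e} {i} {j} i≤j j≤d e<j∸i = begin-strict
  i + (e + (d ∸ j))       <⟨ +-monoʳ-< i (+-monoˡ-< (d ∸ j) e<j∸i) ⟩
  i + ((j ∸ i) + (d ∸ j)) ≡⟨ +-assoc i (j ∸ i) (d ∸ j) ⟨
  i + (j ∸ i) + (d ∸ j)   ≡⟨ cong (_+ (d ∸ j)) (m+[n∸m]≡n i≤j) ⟩
  j + (d ∸ j)             ≡⟨ m+[n∸m]≡n j≤d ⟩
  d                       ∎
  where open ≤-Reasoning

segment-shorter : ∀ {d i j} → i < j → j ≤ d → ¬ (i ≡ 0 × j ≡ d) → j ∸ i < d
segment-shorter {i = zero}  _   j≤d not-closing = ≤∧≢⇒< j≤d (not-closing ∘ (refl ,_))
segment-shorter {i = suc i} i<j j≤d _           = <-≤-trans (∸-monoʳ-< z<s (<⇒≤ i<j)) j≤d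

module Walks {n} (R : Rel (Fin n) 0ℓ) where

  -- A walk of length d as its vertex sequence; `at k` is junk for k > d.
  record Walk (d : ℕ) (u v : Fin n) : Set where
    field
      at       : ℕ → Fin n
      at-start : at 0 ≡ u
      at-end   : at d ≡ v
      edge     : ∀ k → k < d → R (at k) (at (suc k))
  open Walk public

  nil : ∀ {u} → Walk 0 u u
  nil {u} = record { at = λ _ → u ; at-start = refl ; at-end = refl ; edge = λ _ () }

  length0⇒≡ : ∀ {u v} → Walk 0 u v → u ≡ v
  length0⇒≡ w = trans (sym (at-start w)) (at-end w)

  infixr 5 _◅_ _++_

  _◅_ : ∀ {d u x v} → R u x → Walk d x v → Walk (suc d) u v
  _◅_ {u = u} r w = record { at = at′ ; at-start = refl ; at-end = at-end w ; edge = edge′ }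
    where
    at′ : ℕ → Fin _
    at′ zero    = u
    at′ (suc k) = at w k
    edge′ : ∀ k → k < suc _ → R (at′ k) (at′ (suc k))
    edge′ zero    _         = subst (R u) (sym (at-start w)) r
    edge′ (suc k) (s≤s k<d) = edge w k k<d

  uncons : ∀ {d u v} → Walk (suc d) u v → ∃[ x ] R u x × Walk d x v
  uncons w = at w 1 , subst (λ x → R x (at w 1)) (at-start w) (edge w 0 z<s) ,
    record { at = at w ∘ suc ; at-start = refl ; at-end = at-end w
           ; edge = λ k k<d → edge w (suc k) (s≤s k<d) }

  _++_ : ∀ {d₁ d₂ u v w} → Walk d₁ u v → Walk d₂ v w → Walk (d₁ + d₂) u w
  _++_ {zero}   w₁ w₂ = subst (λ x → Walk _ x _) (sym (length0⇒≡ w₁)) w₂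
  _++_ {suc _}  w₁ w₂ with uncons w₁
  ... | _ , r , w₁′ = r ◅ (w₁′ ++ w₂)

  reverse : Symmetric R → ∀ {d u v} → Walk d u v → Walk d v u
  reverse R-sym {d} w = record
    { at       = λ k → at w (d ∸ k)
    ; at-start = at-end w
    ; at-end   = trans (cong (at w) (n∸n≡0 d)) (at-start w)
    ; edge     = λ k k<d → subst (λ i → R (at w i) (at w (d ∸ suc k))) (sym (+-∸-assoc 1 k<d))
                   (R-sym (edge w (d ∸ suc k) (subst (_≤ d) (+-∸-assoc 1 k<d) (m∸n≤m d k))))
    }

  take : ∀ {d u v} (w : Walk d u v) {i} → i ≤ d → Walk i u (at w i)
  take w i≤d = record { at = at w ; at-start = at-start w ; at-end = refl
                      ; edge = λ k k<i → edge w k (<-≤-trans k<i i≤d) }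

  drop : ∀ {d u v} (w : Walk d u v) {i} → i ≤ d → Walk (d ∸ i) (at w i) v
  drop w {i} i≤d = record
    { at       = λ k → at w (i + k)
    ; at-start = cong (at w) (+-identityʳ i)
    ; at-end   = trans (cong (at w) (m+[n∸m]≡n i≤d)) (at-end w)
    ; edge     = λ k k<d∸i → subst (λ j → R (at w (i + k)) (at w j)) (sym (+-suc i k))
                   (edge w (i + k) (subst (i + k <_) (m+[n∸m]≡n i≤d) (+-monoʳ-< i k<d∸i)))
    }

  segment : ∀ {d u v} (w : Walk d u v) {i j} → i ≤ j → j ≤ d → Walk (j ∸ i) (at w i) (at w j)
  segment w i≤j j≤d = drop (take w j≤d) i≤j

  shortcut : ∀ {d e u v} (w : Walk d u v) {i j} → i ≤ j → j ≤ d →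
             Walk e (at w i) (at w j) → Walk (i + (e + (d ∸ j))) u v
  shortcut w i≤j j≤d s = take w (≤-trans i≤j j≤d) ++ s ++ drop w j≤d

  Reachable : Rel (Fin n) 0ℓ
  Reachable u v = ∃[ d ] Walk d u v

  -- Pigeonhole: a walk with at least n steps repeats a vertex, and the loop can be cut out.
  shorten : ∀ d {u v} → Walk d u v → ∃[ i ] Walk (toℕ i) u v
  shorten = <-rec (λ d → ∀ {u v} → Walk d u v → ∃[ i ] Walk (toℕ i) u v) go
    where
    go : ∀ d → (∀ {e} → e < d → ∀ {u v} → Walk e u v → ∃[ i ] Walk (toℕ i) u v) →
         ∀ {u v} → Walk d u v → ∃[ i ] Walk (toℕ i) u v
    go d shorten′ w with d <? n
    ... | yes d<n = fromℕ< d<n , subst (λ e → Walk e _ _) (sym (toℕ-fromℕ< d<n)) w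
    ... | no d≮n with pigeonhole (s≤s (≮⇒≥ d≮n)) (at w ∘ toℕ)
    ... | i , j , i<j , same = shorten′ (shortcut-shorter (<⇒≤ i<j) j≤d (m<n⇒0<n∸m i<j))
                                        (shortcut w (<⇒≤ i<j) j≤d (subst (Walk 0 _) same nil))
      where
      j≤d : toℕ j ≤ d
      j≤d = s≤s⁻¹ (toℕ<n j)

  module _ (R? : Decidable R) where

    walk? : ∀ d → Decidable (Walk d)
    walk? zero    u v = map′ (λ { refl → nil }) length0⇒≡ (u ≟ᶠ v)
    walk? (suc d) u v = map′ (λ (_ , r , w) → r ◅ w) uncons (any? λ x → R? u x ×-dec walk? d x v)

    reachable? : Decidable Reachable
    reachable? u v =
      map′ (λ (i , w) → toℕ i , w) (λ (d , w) → shorten d w) (any? λ i → walk? (toℕ i) u v)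

  reachable-isDecEquivalence : Symmetric R → Decidable R → IsDecEquivalence Reachable
  reachable-isDecEquivalence R-sym R? = record
    { isEquivalence = record
      { refl  = 0 , nil
      ; sym   = λ (d , w) → d , reverse R-sym w
      ; trans = λ (d₁ , w₁) (d₂ , w₂) → d₁ + d₂ , w₁ ++ w₂
      }
    ; _≟_ = reachable? R?
    }

≡-by-steps : ∀ {a} {A : Set a} (g : ℕ → A) k t →
             (∀ s → s < t → g (k + s) ≡ g (suc (k + s))) → g k ≡ g (k + t)
≡-by-steps g k zero    _      = cong g (sym (+-identityʳ k))
≡-by-steps g k (suc t) g-step = trans (≡-by-steps g k t (λ s s<t → g-step s (m<n⇒m<1+n s<t)))
                                      (trans (g-step t (n<1+n t)) (cong g (sym (+-suc k t))))

[m+n]%o≢m : ∀ m {n o} .{{_ : NonZero o}} → 0 < n → n < o → (m + n) % o ≢ m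
[m+n]%o≢m m {n} {o} 0<n n<o eq = multiple {q} (+-cancelˡ-≡ m n (q * o) m+n≡m+qo)
  where
  q : ℕ
  q = (m + n) / o
  m+n≡m+qo : m + n ≡ m + q * o
  m+n≡m+qo = trans (m≡m%n+[m/n]*n (m + n) o) (cong (_+ q * o) eq)
  multiple : ∀ {k} → n ≢ k * o
  multiple {zero}  n≡0    = <-irrefl (sym n≡0) 0<n
  multiple {suc k} n≡o+ko = <⇒≱ n<o (subst (o ≤_) (sym n≡o+ko) (m≤m+n o (k * o)))

[1+m%n]%n≡[1+m]%n : ∀ m n .{{_ : NonZero n}} → suc (m % n) % n ≡ suc m % n
[1+m%n]%n≡[1+m]%n m n = begin
  suc (m % n) % n           ≡⟨ %-distribˡ-+ 1 (m % n) n ⟩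
  (1 % n + m % n % n) % n   ≡⟨ cong (λ r → (1 % n + r) % n) (m%n%n≡m%n m n) ⟩
  (1 % n + m % n) % n       ≡⟨ %-distribˡ-+ 1 m n ⟨
  suc m % n                 ∎
  where open ≡-Reasoning

module _ (G : Graph) {m : ℕ} where

  toℕ-next : ∀ i → toℕ (next G {m} i) ≡ suc (toℕ i) % suc m
  toℕ-next i = toℕ-fromℕ< _

  toℕ-next-< : ∀ i → toℕ i < m → toℕ (next G {m} i) ≡ suc (toℕ i)
  toℕ-next-< i i<m = trans (toℕ-next i) (m<n⇒m%n≡m (s≤s i<m))

  toℕ-next-last : ∀ i → toℕ i ≡ m → toℕ (next G {m} i) ≡ 0
  toℕ-next-last i i≡m = trans (toℕ-next i) (trans (cong (λ k → suc k % suc m) i≡m) (n%n≡0 (suc m)))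

  next-mod : ∀ k → next G (k mod suc m) ≡ suc k mod suc m
  next-mod k = toℕ-injective (begin
    toℕ (next G (k mod suc m))      ≡⟨ toℕ-next (k mod suc m) ⟩
    suc (toℕ (k mod suc m)) % suc m ≡⟨ cong (λ r → suc r % suc m) (toℕ-fromℕ< _) ⟩
    suc (k % suc m) % suc m         ≡⟨ [1+m%n]%n≡[1+m]%n k (suc m) ⟩
    suc k % suc m                   ≡⟨ toℕ-fromℕ< _ ⟨
    toℕ (suc k mod suc m)           ∎)
    where open ≡-Reasoning

  -- Walk once around the cycle from next x to x, through all the other steps.
  step-closes-cycle : ∀ {a} {A : Set a} (h : Fin (suc m) → A) x →
                      (∀ i → i ≢ x → h i ≡ h (next G i)) → h (next G x) ≡ h x
  step-closes-cycle {A = A} h x h≡ = trans (≡-by-steps g (suc (toℕ x)) m around) (cong h back)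
    where
    g : ℕ → A
    g k = h (k mod suc m)
    around : ∀ s → s < m → g (suc (toℕ x) + s) ≡ g (suc (suc (toℕ x) + s))
    around s s<m = trans (h≡ _ avoids-x) (cong h (next-mod (suc (toℕ x) + s)))
      where
      avoids-x : (suc (toℕ x) + s) mod suc m ≢ x
      avoids-x eq = [m+n]%o≢m (toℕ x) z<s (s≤s s<m)
        (trans (cong (_% suc m) (+-suc (toℕ x) s)) (trans (sym (toℕ-fromℕ< _)) (cong toℕ eq)))
    back : (suc (toℕ x) + m) mod suc m ≡ x
    back = toℕ-injective (trans (toℕ-fromℕ< _) (trans (cong (_% suc m) (sym (+-suc (toℕ x) m)))
             (trans ([m+n]%n≡m%n (toℕ x) (suc m)) (m<n⇒m%n≡m (toℕ<n x)))))

module _ (G : Graph) (K : EdgeSubset G) where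
  open Graph G using (n; Adj) renaming (sym to Adj-sym; irrefl to Adj-irrefl)
  open EdgeSubset K using (In; in?; sub) renaming (sym to In-sym)
  open Walks In

  CycleCondition : Set
  CycleCondition = ∀ m (C : ChordlessCycle G m) → missing G K C ≢ 1

  outside-K? : ∀ {m} (C : ChordlessCycle G m) → let open ChordlessCycle C in
               Decidable₁ λ i → ¬ In (vtx i) (vtx (next G i))
  outside-K? C i = ¬? (in? (vtx i) (vtx (next G i)))
    where open ChordlessCycle C

  EΠ⇒cycle-condition : ∀ c → (∀ u v → In u v ⇔ EΠ G c u v) → CycleCondition
  EΠ⇒cycle-condition c K⇔EΠ m C one-missing
    with x , x∉K , only-x ← length-filter≡1⇒ (outside-K? C) (allFin _) one-missing =
    x∉K (Equivalence.from (K⇔EΠ _ _) (edges x , sym (step-closes-cycle G (c ∘ vtx) x same-block)))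
    where
    open ChordlessCycle C
    same-block : ∀ i → i ≢ x → c (vtx i) ≡ c (vtx (next G i))
    same-block i i≢x = proj₂ (Equivalence.to (K⇔EΠ _ _)
      (decidable-stable (in? _ _) (i≢x ∘ only-x (∈-allFin i))))

  open Representative (reachable-isDecEquivalence In-sym in?)

  component : Partition G
  component = rep

  K⊆EΠ : ∀ {u v} → In u v → EΠ G component u v
  K⊆EΠ r = sub r , ∼⇒rep≡ (1 , r ◅ nil)

  walkIn : ∀ {P : Fin n → Set} → (∀ {x y} → In x y → P x → P y) →
           ∀ {d x v} → Walk d x v → P x → WalkIn G P x v
  walkIn closed {zero}  w px = subst (WalkIn G _ _) (length0⇒≡ w) (stay px)
  walkIn closed {suc d} w px with _ , r , w′ ← uncons w =
    step px (sub r) (walkIn closed w′ (closed r px))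

  component-connPac : IsConnPac G component
  component-connPac u v same =
    walkIn (λ r same-as-u → trans (sym (proj₂ (K⊆EΠ r))) same-as-u) (proj₂ (rep≡⇒∼ same)) refl

  Repeats : ∀ {d u v} → Walk d u v → Set
  Repeats {d} w = ∃₂ λ i j → i < j × j ≤ d × at w i ≡ at w j

  -- Chords of the closed walk w followed by the edge vu, other than vu itself.
  HasChord : ∀ {d u v} → Walk d u v → Set
  HasChord {d} w = ∃₂ λ i j → suc i < j × j ≤ d × ¬ (i ≡ 0 × j ≡ d) × Adj (at w i) (at w j)

  module Closing {m u v} (w : Walk (2 + m) u v) (uv : Adj u v)
                 (no-repeat : ¬ Repeats w) (no-chord : ¬ HasChord w) where

    vtx : Fin (3 + m) → Fin n
    vtx i = at w (toℕ i)

    bound : ∀ i → toℕ i ≤ 2 + m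
    bound i = s≤s⁻¹ (toℕ<n i)

    along : ∀ i → toℕ i < 2 + m → In (vtx i) (vtx (next G i))
    along i i<d = subst (In (vtx i) ∘ at w) (sym (toℕ-next-< G i i<d)) (edge w (toℕ i) i<d)

    closing : ∀ i → toℕ i ≡ 2 + m → vtx i ≡ v × vtx (next G i) ≡ u
    closing i i≡d = trans (cong (at w) i≡d) (at-end w) ,
                    trans (cong (at w) (toℕ-next-last G i i≡d)) (at-start w)

    edges : ∀ i → Adj (vtx i) (vtx (next G i))
    edges i with m≤n⇒m<n∨m≡n (bound i)
    ... | inj₁ i<d = sub (along i i<d)
    ... | inj₂ i≡d = let vi≡v , vi+1≡u = closing i i≡d in
                     subst₂ Adj (sym vi≡v) (sym vi+1≡u) (Adj-sym uv)

    distinct : ∀ {i j} → vtx i ≡ vtx j → i ≡ j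
    distinct {i} {j} same with <-cmp (toℕ i) (toℕ j)
    ... | tri< i<j _ _ = ⊥-elim (no-repeat (toℕ i , toℕ j , i<j , bound j , same))
    ... | tri≈ _ i≡j _ = toℕ-injective i≡j
    ... | tri> _ _ j<i = ⊥-elim (no-repeat (toℕ j , toℕ i , j<i , bound i , sym same))

    chordless-< : ∀ i j → toℕ i < toℕ j → Adj (vtx i) (vtx j) → (j ≡ next G i) ⊎ (i ≡ next G j)
    chordless-< i j i<j a with toℕ j ≟ suc (toℕ i) | (toℕ i ≟ 0) ×-dec (toℕ j ≟ 2 + m)
    ... | yes j≡1+i | _ =
      inj₁ (toℕ-injective (trans j≡1+i (sym (toℕ-next-< G i (<-≤-trans i<j (bound j))))))
    ... | no _ | yes (i≡0 , j≡d) = inj₂ (toℕ-injective (trans i≡0 (sym (toℕ-next-last G j j≡d))))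
    ... | no j≢1+i | no not-closing =
      ⊥-elim (no-chord (toℕ i , toℕ j , ≤∧≢⇒< i<j (j≢1+i ∘ sym) , bound j , not-closing , a))

    chordless : ∀ i j → Adj (vtx i) (vtx j) → (j ≡ next G i) ⊎ (i ≡ next G j)
    chordless i j a with <-cmp (toℕ i) (toℕ j)
    ... | tri< i<j _ _ = chordless-< i j i<j a
    ... | tri≈ _ i≡j _ = ⊥-elim (Adj-irrefl (cong (at w) i≡j) a)
    ... | tri> _ _ j<i = swap (chordless-< j i j<i (Adj-sym a))

    cycle : ChordlessCycle G m
    cycle = record { vtx = vtx ; distinct = distinct ; edges = edges ; chordless = chordless }

    missing≡1 : ¬ In u v → missing G K cycle ≡ 1
    missing≡1 uv∉K = length-filter≡1 (outside-K? cycle) (allFin⁺ _) (∈-allFin last) last∉K only-last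
      where
      last : Fin (3 + m)
      last = fromℕ (2 + m)
      last∉K : ¬ In (vtx last) (vtx (next G last))
      last∉K r = let vl≡v , vl+1≡u = closing last (toℕ-fromℕ _) in
                 uv∉K (In-sym (subst₂ In vl≡v vl+1≡u r))
      only-last : ∀ {i} → ¬ In (vtx i) (vtx (next G i)) → i ≡ last
      only-last {i} i∉K with m≤n⇒m<n∨m≡n (bound i)
      ... | inj₁ i<d = ⊥-elim (i∉K (along i i<d))
      ... | inj₂ i≡d = toℕ-injective (trans i≡d (sym (toℕ-fromℕ _)))

  module _ (cycle-condition : CycleCondition) where

    closing-edge∈K : ∀ {d u v} → Walk d u v → Adj u v → In u v
    closing-edge∈K {d} = <-rec (λ d → ∀ {u v} → Walk d u v → Adj u v → In u v) go d
      where
      go : ∀ d → (∀ {e} → e < d → ∀ {u v} → Walk e u v → Adj u v → In u v) →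
           ∀ {u v} → Walk d u v → Adj u v → In u v
      go zero          _  w uv = ⊥-elim (Adj-irrefl (length0⇒≡ w) uv)
      go (suc zero)    _  w uv = subst₂ In (at-start w) (at-end w) (edge w 0 z<s)
      -- As `In` is decidable it suffices to refute uv ∉ K, so `Repeats w ⊎ HasChord w` need not be decided.
      go (suc (suc m)) ih {u} {v} w uv = decidable-stable (in? u v) λ uv∉K →
        ¬¬-excluded-middle {A = Repeats w ⊎ HasChord w} λ where
          (yes (inj₁ (i , j , i<j , j≤d , same))) → uv∉K (ih
            (shortcut-shorter (<⇒≤ i<j) j≤d (m<n⇒0<n∸m i<j))
            (shortcut w (<⇒≤ i<j) j≤d (subst (Walk 0 _) same nil)) uv)
          (yes (inj₂ (i , j , 1+i<j , j≤d , not-closing , chord))) →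
            let i<j = <-trans (n<1+n i) 1+i<j
                chord∈K = ih (segment-shorter i<j j≤d not-closing) (segment w (<⇒≤ i<j) j≤d) chord
            in uv∉K (ih (shortcut-shorter (<⇒≤ i<j) j≤d (m+n≤o⇒m≤o∸n 2 1+i<j))
                        (shortcut w (<⇒≤ i<j) j≤d (chord∈K ◅ nil)) uv)
          (no neither) → let open Closing w uv (neither ∘ inj₁) (neither ∘ inj₂) in
            cycle-condition m cycle (missing≡1 uv∉K)

    EΠ⊆K : ∀ {u v} → EΠ G component u v → In u v
    EΠ⊆K (uv , same) = closing-edge∈K (proj₂ (rep≡⇒∼ same)) uv

lemma10 : (G : Graph) (K : EdgeSubset G) →
    (Σ (Partition G) λ c → IsConnPac G c ×
        (∀ u v → EdgeSubset.In K u v ⇔ EΠ G c u v))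
    ⇔ (∀ (m : ℕ) (C : ChordlessCycle G m) → missing G K C ≢ 1)
lemma10 G K = mk⇔
  (λ (c , _ , K⇔EΠ) → EΠ⇒cycle-condition G K c K⇔EΠ)
  (λ cycle-condition → component G K , component-connPac G K ,
     λ u v → mk⇔ (K⊆EΠ G K) (EΠ⊆K G K cycle-condition))
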